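{- Let $p,q$ be distinct atoms and $\varphi:=\Box(p\wedge q)\to[\ddagger(p\wedge q)](\Box p\vee\Box q)$. Then $\varphi$ is valid under the uniform semantics $\models_u$ (true at every world of every Kripke model), but $\varphi$ is not valid under the dependent semantics $\models_d$; moreover, this remains so when restricting to the class of $\mathsf{S5}$ models (models whose relation is an equivalence relation), i.e. there is an $\mathsf{S5}$ model and a world at which $\varphi$ fails under $\models_d$.
   Context: Atoms come from a countable non-empty set $\mathit{At}$. A Kripke model $\mathcal M=\langle W,R,V\rangle$ has $W\neq\varnothing$, $R\subseteq W\times W$, $V:\mathit{At}\to\mathcal P(W)$; $\Box$ and booleans are interpreted standardly in both semantics. A literal is an atom or its negation; a clause is a finite set $D$ of literals read as $\bigvee D$ ($\bigvee\varnothing=\bot$); it is tautological if it contains $p$ and $\neg p$ for some $p$. For propositional $\pi$, $\mathcal C(\pi)$ is the set of non-tautological clauses $D$ with $\models\pi\to\bigvee D$ such that no $D'\subsetneq D$ has $\models\pi\to\bigvee D'$. Uniform semantics: for non-tautological clauses $D_1,D_2$, $\mathcal M^{\{D_1,D_2\}}_u=\langle W',R',V'\rangle$ has $W'=W\times\{0,1,2\}$, $(w,i)R'(v,j)$ iff $wRv$, $(w,0)\in V'(p)$ iff $w\in V(p)$, and for $i\in\{1,2\}$: $(w,i)\in V'(p)$ iff $\neg p\in D_i$, or ($\{p,\neg p\}\cap D_i=\varnothing$ and $w\in V(p)$); $\mathcal M,w\models_u[\ddagger\pi]\psi$ iff for all $D_1\in\mathcal C(\pi)$, $D_2\in\mathcal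 C(\neg\pi)$, $\mathcal M^{\{D_1,D_2\}}_u,(w,0)\models_u\psi$. Dependent semantics: for functions $f_1:W\to\mathcal C(\pi)$, $f_2:W\to\mathcal C(\neg\pi)$, $\mathcal M^{(f_1,f_2)}_d$ has domain $W\times\{0,1,2\}$, $(w,i)R(v,j)$ iff $wRv$, $(w,0)\in V(p)$ iff $w\in V(p)$, and for $i\in\{1,2\}$: $(w,i)\in V(p)$ iff either $\{p,\neg p\}\cap f_i(w)=\varnothing$ and $w\in V(p)$, or $\neg p\in f_i(w)$; $\mathcal M,w\models_d[\ddagger\pi]\psi$ iff for all $f_1:W\to\mathcal C(\pi)$ and $f_2:W\to\mathcal C(\neg\pi)$, $\mathcal M^{(f_1,f_2)}_d,(w,0)\models_d\psi$. -}

module Defs where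

open import Data.Bool using (Bool; true; false; _∧_; _∨_; not)
open import Data.Fin using (Fin; zero; suc)
open import Data.List using (List)
open import Data.List.Membership.Propositional using (_∈_; _∉_)
open import Data.List.Relation.Unary.Any using (Any)
open import Data.Product using (Σ; ∃; _×_; _,_; proj₁)
open import Data.Sum using (_⊎_)
open import Data.Empty using (⊥)
open import Relation.Nullary using (¬_)
open import Relation.Binary.PropositionalEquality using (_≡_)
open import Relation.Binary.Structures using (IsEquivalence)

module _ {At : Set} where

  data PForm : Set where
    patom : At → PForm
    pbot  : PForm
    pneg  : PForm → PForm
    pand  : PForm → PForm → PForm
    por   : PForm → PForm → PForm
    pimp  : PForm → PForm → PForm

  evalP : (At → Bool) → PForm → Bool
  evalP v (patom a) = v a
  evalP v pbot      = false
  evalP v (pneg φ)  = not (evalP v φ)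
  evalP v (pand φ ψ) = evalP v φ ∧ evalP v ψ
  evalP v (por φ ψ)  = evalP v φ ∨ evalP v ψ
  evalP v (pimp φ ψ) = not (evalP v φ) ∨ evalP v ψ

  data Literal : Set where
    pos : At → Literal
    neg : At → Literal

  -- a clause is a finite set of literals, represented by a list
  -- (set-theoretic notions below only use membership)
  Clause : Set
  Clause = List Literal

  litTrue : (At → Bool) → Literal → Set
  litTrue v (pos a) = v a ≡ true
  litTrue v (neg a) = v a ≡ false

  clauseTrue : (At → Bool) → Clause → Set
  clauseTrue v D = Any (litTrue v) D

  Tautological : Clause → Set
  Tautological D = ∃ λ a → (pos a ∈ D) × (neg a ∈ D)

  Entails : PForm → Clause → Set
  Entails π D = (v : At → Bool) → evalP v π ≡ true → clauseTrue v D

  _⊆_ : Clause → Clause → Set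
  D' ⊆ D = ∀ {l} → l ∈ D' → l ∈ D

  _⊊_ : Clause → Clause → Set
  D' ⊊ D = (D' ⊆ D) × (∃ λ l → (l ∈ D) × (l ∉ D'))

  InC : PForm → Clause → Set
  InC π D = (¬ Tautological D) × Entails π D
            × ((D' : Clause) → D' ⊊ D → ¬ Entails π D')

  data Form : Set where
    atom : At → Form
    fbot : Form
    fneg : Form → Form
    fand : Form → Form → Form
    for  : Form → Form → Form
    fimp : Form → Form → Form
    box  : Form → Form
    dag  : PForm → Form → Form

record Model (At : Set) : Set₁ where
  field
    W     : Set
    R     : W → W → Set
    V     : At → W → Set
    point : W                -- W ≠ ∅

open Model public

module _ {At : Set} where

  updAtom : Clause {At} → Set → At → Set
  updAtom D inV a = (neg a ∈ D) ⊎ (((pos a ∉ D) × (neg a ∉ D)) × inV)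

  uniUpd : Model At → Clause {At} → Clause {At} → Model At
  uniUpd M D₁ D₂ = record
    { W = W M × Fin 3
    ; R = λ { (w , i) (v , j) → R M w v }
    ; V = λ { a (w , zero) → V M a w
            ; a (w , suc zero) → updAtom D₁ (V M a w) a
            ; a (w , suc (suc zero)) → updAtom D₂ (V M a w) a }
    ; point = point M , zero
    }

  depUpd : (M : Model At) → (W M → Clause {At}) → (W M → Clause {At}) → Model At
  depUpd M f₁ f₂ = record
    { W = W M × Fin 3
    ; R = λ { (w , i) (v , j) → R M w v }
    ; V = λ { a (w , zero) → V M a w
            ; a (w , suc zero) → updAtom (f₁ w) (V M a w) a
            ; a (w , suc (suc zero)) → updAtom (f₂ w) (V M a w) a }
    ; point = point M , zero
    }

  satU : (M : Model At) → W M → Form {At} → Set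
  satU M w (atom a)   = V M a w
  satU M w fbot       = ⊥
  satU M w (fneg φ)   = ¬ satU M w φ
  satU M w (fand φ ψ) = satU M w φ × satU M w ψ
  satU M w (for φ ψ)  = satU M w φ ⊎ satU M w ψ
  satU M w (fimp φ ψ) = satU M w φ → satU M w ψ
  satU M w (box φ)    = ∀ v → R M w v → satU M v φ
  satU M w (dag π ψ)  =
    (D₁ : Clause) → InC π D₁ → (D₂ : Clause) → InC (pneg π) D₂ →
    satU (uniUpd M D₁ D₂) (w , zero) ψ

  satD : (M : Model At) → W M → Form {At} → Set
  satD M w (atom a)   = V M a w
  satD M w fbot       = ⊥
  satD M w (fneg φ)   = ¬ satD M w φ
  satD M w (fand φ ψ) = satD M w φ × satD M w ψ
  satD M w (for φ ψ)  = satD M w φ ⊎ satD M w ψ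
  satD M w (fimp φ ψ) = satD M w φ → satD M w ψ
  satD M w (box φ)    = ∀ v → R M w v → satD M v φ
  satD M w (dag π ψ)  =
    (f₁ : W M → Σ Clause (InC π)) → (f₂ : W M → Σ Clause (InC (pneg π))) →
    satD (depUpd M (λ x → proj₁ (f₁ x)) (λ x → proj₁ (f₂ x))) (w , zero) ψ

  IsS5 : Model At → Set
  IsS5 M = IsEquivalence (R M)

  phi37 : At → At → Form {At}
  phi37 p q = fimp (box (fand (atom p) (atom q)))
                   (dag (pand (patom p) (patom q)) (for (box (atom p)) (box (atom q))))

-- An implicate of p ∧ q that is prime is {p} or {q}, and every non-tautological
-- implicate of ¬(p ∧ q) contains ¬p and ¬q. In the uniform update the first copy
-- therefore leaves one of p, q untouched (say q), while the second copy makes q true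
-- (a literal ¬q in the clause sets q); together with the original copy this gives □q.
-- The dependent update may choose {p} at one world and {q} at another: in an S5
-- model with two worlds where all atoms hold, this falsifies p in one copy and q in
-- another, so neither □p nor □q survives.
module Submission where

open import Defs
open import Data.Nat using (ℕ)
open import Data.Product using (Σ; _×_)
open import Relation.Nullary using (¬_)
open import Relation.Binary.PropositionalEquality using (_≡_; _≢_)
open import Function.Definitions using (Injective)

open import Data.Bool using (Bool; true; false; not; _∧_; if_then_else_)
open import Data.Bool.Properties using (∧-zeroʳ)
open import Data.Empty using (⊥-elim)
open import Data.Fin using (zero; suc)
open import Data.List using (List; []; _∷_; [_])
open import Data.List.Membership.Propositional using (_∈_; _∉_; find)
import Data.List.Membership.DecPropositional as DecMembership
open import Data.List.Relation.Unary.Any using (here; there)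
open import Data.List.Relation.Unary.Any.Properties using (singleton⁻)
open import Data.Product using (_,_; proj₁; proj₂)
open import Data.Sum using (_⊎_; inj₁; inj₂)
open import Data.Unit using (⊤; tt)
import Data.Nat.Properties as ℕ
open import Function.Bundles using (mk↣)
open import Relation.Nullary using (yes; no; does)
open import Relation.Nullary.Decidable using (map′; via-injection)
open import Relation.Binary.Definitions using (DecidableEquality)
open import Relation.Binary.PropositionalEquality using (refl; sym; trans; cong; cong₂; subst)

∧-true-left : ∀ {a b} → a ∧ b ≡ true → a ≡ true
∧-true-left {true} _ = refl

∧-true-right : ∀ {a b} → a ∧ b ≡ true → b ≡ true
∧-true-right {true} b≡true = b≡true

module _ {At : Set} where

  atomOf : Literal {At} → At
  atomOf (pos a) = a
  atomOf (neg a) = a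

  literal : Bool → At → Literal {At}
  literal true  = pos
  literal false = neg

  Avoids : At → Clause {At} → Set
  Avoids a D = pos a ∉ D × neg a ∉ D

  ¬Tautological-⊆ : {D D' : Clause {At}} → D' ⊆ D → ¬ Tautological D → ¬ Tautological D'
  ¬Tautological-⊆ D'⊆D ¬taut (a , a∈D' , ¬a∈D') = ¬taut (a , D'⊆D a∈D' , D'⊆D ¬a∈D')

  unit-InC : ∀ {π l} → Σ (At → Bool) (λ v → evalP v π ≡ true) → Entails π [ l ] → InC π [ l ]
  unit-InC {π} {l} (v , π-true) entails = ¬taut , entails , minimal
    where
      ¬taut : ¬ Tautological [ l ]
      ¬taut (_ , here refl , here ())
      ¬taut (_ , there () , _)
      ¬taut (_ , _ , there ())

      minimal : (D' : Clause) → D' ⊊ [ l ] → ¬ Entails π D'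
      minimal D' (D'⊆ , m , here refl , m∉D') entails' =
        let l' , l'∈D' , _ = find (entails' v π-true)
        in m∉D' (subst (_∈ D') (singleton⁻ (D'⊆ l'∈D')) l'∈D')

  uniUpd-□ : ∀ {M w D₁ D₂ x} → Avoids x D₁ → neg x ∈ D₂ →
             satU M w (box (atom x)) → satU (uniUpd M D₁ D₂) (w , zero) (box (atom x))
  uniUpd-□ avoids ¬x∈D₂ □x (v , zero)          wRv = □x v wRv
  uniUpd-□ avoids ¬x∈D₂ □x (v , suc zero)       wRv = inj₂ (avoids , □x v wRv)
  uniUpd-□ avoids ¬x∈D₂ □x (v , suc (suc zero)) wRv = inj₁ ¬x∈D₂

  ¬updAtom-unit : ∀ {x : At} {A : Set} → ¬ updAtom [ pos x ] A x
  ¬updAtom-unit (inj₁ (here ()))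
  ¬updAtom-unit (inj₁ (there ()))
  ¬updAtom-unit (inj₂ ((x∉ , _) , _)) = x∉ (here refl)

module Implicates {At : Set} (_≟_ : DecidableEquality At) where

  _≟ₗ_ : DecidableEquality (Literal {At})
  pos a ≟ₗ pos b = map′ (cong pos) (cong atomOf) (a ≟ b)
  neg a ≟ₗ neg b = map′ (cong neg) (cong atomOf) (a ≟ b)
  pos _ ≟ₗ neg _ = no λ ()
  neg _ ≟ₗ pos _ = no λ ()

  open DecMembership _≟_ using () renaming (_∈?_ to _∈ₐ?_)
  open DecMembership _≟ₗ_ using (_∈?_)

  -- Pins the atoms of S to b and falsifies every other literal of D; this is
  -- consistent when D is not tautological.
  refuting : Bool → List At → Clause → At → Bool
  refuting b S D a = if does (a ∈ₐ? S) then b else does (neg a ∈? D)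

  refuting-pinned : ∀ {a} b S D → a ∈ S → refuting b S D a ≡ b
  refuting-pinned {a} _ S _ a∈S with a ∈ₐ? S
  ... | yes _   = refl
  ... | no a∉S = ⊥-elim (a∉S a∈S)

  refuting-true-literal : ∀ {b S D l} → ¬ Tautological D → l ∈ D →
    litTrue (refuting b S D) l → Σ At λ a → a ∈ S × l ≡ literal b a
  refuting-true-literal {S = S} {D} {pos a} ¬taut a∈D l-true with a ∈ₐ? S | neg a ∈? D
  ... | yes a∈S | _        = a , a∈S , cong (λ c → literal c a) (sym l-true)
  ... | no _    | yes ¬a∈D = ⊥-elim (¬taut (a , a∈D , ¬a∈D))
  ... | no _    | no _     with () ← l-true
  refuting-true-literal {S = S} {D} {neg a} ¬taut ¬a∈D l-true with a ∈ₐ? S | neg a ∈? D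
  ... | yes a∈S | _        = a , a∈S , cong (λ c → literal c a) (sym l-true)
  ... | no _    | yes _    with () ← l-true
  ... | no _    | no ¬a∉D = ⊥-elim (¬a∉D ¬a∈D)

  pinned-literal∈ : ∀ {π D} b S → ¬ Tautological D → Entails π D →
    evalP (refuting b S D) π ≡ true → Σ At λ a → a ∈ S × literal b a ∈ D
  pinned-literal∈ b S ¬taut entails π-true with find (entails _ π-true)
  ... | l , l∈D , l-true with refuting-true-literal {b} {S} ¬taut l∈D l-true
  ... | a , a∈S , refl = a , a∈S , l∈D

  neg∈implicate : ∀ {π D} x → ¬ Tautological D → Entails π D →
    (∀ v → v x ≡ false → evalP v π ≡ true) → neg x ∈ D
  neg∈implicate {π} {D} x ¬taut entails π-if-¬x
    with pinned-literal∈ {π} false [ x ] ¬taut entails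
           (π-if-¬x _ (refuting-pinned false [ x ] D (here refl)))
  ... | _ , here refl , ¬x∈D = ¬x∈D

  InC-unit-only : ∀ {π D l l'} → InC π D → l ∈ D → Entails π [ l ] → l' ∈ D → l' ≡ l
  InC-unit-only {l = l} {l'} (_ , _ , minimal) l∈D entails l'∈D with l' ≟ₗ l
  ... | yes l'≡l = l'≡l
  ... | no l'≢l  = ⊥-elim (minimal [ l ] ((λ { (here refl) → l∈D }) , l' , l'∈D ,
                                            λ { (here l'≡l) → l'≢l l'≡l }) entails)

  InC-unit-avoids : ∀ {π D x y} → InC π D → pos x ∈ D → Entails π [ pos x ] → y ≢ x → Avoids y D
  InC-unit-avoids {π} c x∈D entails y≢x =
      (λ y∈D → y≢x (cong atomOf (InC-unit-only {π} c x∈D entails y∈D)))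
    , (λ ¬y∈D → neg≢pos (InC-unit-only {π} c x∈D entails ¬y∈D))
    where
      neg≢pos : ∀ {a b} → neg a ≢ pos b
      neg≢pos ()

module Conjunction {At : Set} (_≟_ : DecidableEquality At) {p q : At} (p≢q : p ≢ q) where

  open Implicates _≟_

  p∧q : PForm {At}
  p∧q = pand (patom p) (patom q)

  entails-p : Entails p∧q [ pos p ]
  entails-p v p∧q-true = here (∧-true-left p∧q-true)

  entails-q : Entails p∧q [ pos q ]
  entails-q v p∧q-true = here (∧-true-right {v p} p∧q-true)

  InC-p∧q-avoids : ∀ {D} → InC p∧q D → Avoids q D ⊎ Avoids p D
  InC-p∧q-avoids {D} c@(¬taut , entails , _)
    with pinned-literal∈ {p∧q} true (p ∷ q ∷ []) ¬taut entails
           (cong₂ _∧_ (refuting-pinned true (p ∷ q ∷ []) D (here refl))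
                      (refuting-pinned true (p ∷ q ∷ []) D (there (here refl))))
  ... | _ , here refl , p∈D         = inj₁ (InC-unit-avoids {p∧q} c p∈D entails-p (λ q≡p → p≢q (sym q≡p)))
  ... | _ , there (here refl) , q∈D = inj₂ (InC-unit-avoids {p∧q} c q∈D entails-q p≢q)

  implicate-¬[p∧q] : ∀ {D} → ¬ Tautological D → Entails (pneg p∧q) D → neg p ∈ D × neg q ∈ D
  implicate-¬[p∧q] ¬taut entails =
      neg∈implicate {pneg p∧q} p ¬taut entails (λ v vp≡false → cong (λ b → not (b ∧ v q)) vp≡false)
    , neg∈implicate {pneg p∧q} q ¬taut entails
        (λ v vq≡false → trans (cong (λ b → not (v p ∧ b)) vq≡false) (cong not (∧-zeroʳ (v p))))

  φ-uniformly-valid : (M : Model At) (w : W M) → satU M w (phi37 p q)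
  φ-uniformly-valid M w □p∧q D₁ c₁ D₂ (¬taut₂ , entails₂ , _)
    with InC-p∧q-avoids c₁ | implicate-¬[p∧q] ¬taut₂ entails₂
  ... | inj₁ avoids-q | _ , ¬q∈D₂ = inj₂ (uniUpd-□ avoids-q ¬q∈D₂ λ v wRv → proj₂ (□p∧q v wRv))
  ... | inj₂ avoids-p | ¬p∈D₂ , _ = inj₁ (uniUpd-□ avoids-p ¬p∈D₂ λ v wRv → proj₁ (□p∧q v wRv))

  ¬p∨¬q : Clause {At}
  ¬p∨¬q = neg p ∷ neg q ∷ []

  InC-¬p∨¬q : InC (pneg p∧q) ¬p∨¬q
  InC-¬p∨¬q = ¬taut , entails , minimal
    where
      ¬taut : ¬ Tautological ¬p∨¬q
      ¬taut (_ , here () , _)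
      ¬taut (_ , there (here ()) , _)
      ¬taut (_ , there (there ()) , _)

      entails : Entails (pneg p∧q) ¬p∨¬q
      entails v _ with v p in vp | v q in vq
      ... | false | _     = here vp
      ... | true  | false = there (here vq)

      -- every strict subclause misses ¬p or ¬q, which any implicate must contain
      minimal : (D' : Clause) → D' ⊊ ¬p∨¬q → ¬ Entails (pneg p∧q) D'
      minimal D' (D'⊆ , m , m∈ , m∉D') entails'
        with implicate-¬[p∧q] (¬Tautological-⊆ D'⊆ ¬taut) entails' | m∈
      ... | ¬p∈D' , _ | here refl         = m∉D' ¬p∈D'
      ... | _ , ¬q∈D' | there (here refl) = m∉D' ¬q∈D'

  twoWorlds : Model At
  twoWorlds = record { W = Bool ; R = λ _ _ → ⊤ ; V = λ _ _ → ⊤ ; point = true }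

  twoWorlds-S5 : IsS5 twoWorlds
  twoWorlds-S5 = record { refl = tt ; sym = λ _ → tt ; trans = λ _ _ → tt }

  p∧q-satisfiable : Σ (At → Bool) (λ v → evalP v p∧q ≡ true)
  p∧q-satisfiable = (λ _ → true) , refl

  unitClauseAt : Bool → Σ Clause (InC p∧q)
  unitClauseAt true  = [ pos p ] , unit-InC {π = p∧q} p∧q-satisfiable entails-p
  unitClauseAt false = [ pos q ] , unit-InC {π = p∧q} p∧q-satisfiable entails-q

  φ-dependently-fails : ¬ satD twoWorlds true (phi37 p q)
  φ-dependently-fails φ-holds with φ-holds (λ _ _ → tt , tt) unitClauseAt (λ _ → ¬p∨¬q , InC-¬p∨¬q)
  ... | inj₁ □p = ¬updAtom-unit (□p (true , suc zero) tt)
  ... | inj₂ □q = ¬updAtom-unit (□q (false , suc zero) tt)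

proposition37 : (At : Set) (ι : At → ℕ) → Injective _≡_ _≡_ ι →
    (p q : At) → p ≢ q →
    ((M : Model At) (w : W M) → satU M w (phi37 p q))
    × (¬ ((M : Model At) (w : W M) → satD M w (phi37 p q)))
    × Σ (Model At) (λ M → IsS5 M × Σ (W M) (λ w → ¬ satD M w (phi37 p q)))
proposition37 At ι ι-injective p q p≢q =
    φ-uniformly-valid
  , (λ valid → φ-dependently-fails (valid twoWorlds true))
  , (twoWorlds , twoWorlds-S5 , true , φ-dependently-fails)
  where
    _≟_ : DecidableEquality At
    _≟_ = via-injection (mk↣ ι-injective) ℕ._≟_

    open Conjunction _≟_ p≢q
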